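{- Let $G$ be a finite group, let $I$ be a subgroup of $G$, and let $i:I^\sharp\to G^\sharp$ be the map induced by inclusion. Then the formal Artin character $a_I$ of $G$ satisfies \[ a_I=\frac{1}{|I|}\sum_{\sigma\in I^{\sharp0}} u_{I,\sigma}\,[\sigma]\,\bar\sigma\,a_{i(\sigma)}, \] where $[\sigma]$, $\bar\sigma$ and $u_{I,\sigma}$ are computed in the group $I$ and $a_{i(\sigma)}$ is the tame character of $G$ attached to the class $i(\sigma)\in G^\sharp$.
   Context: For a finite group $H$: two elements are power-conjugate if each is conjugate to a power of the other; $H^\sharp$ is the set of power-conjugacy classes, $e$ the identity class, $H^{\sharp0}=H^\sharp\setminus\{e\}$, $C_\sigma$ the set of elements in class $\sigma$, $\bar\sigma$ the order of its elements, and $[\sigma]=|C_\sigma|/\varphi(\bar\sigma)$ with $\varphi$ Euler's function. Write $\tau\mid\sigma$ if some power of an element of $C_\sigma$ lies in $C_\tau$, and put $d(\tau,\sigma)=[\sigma]/[\tau]$. The integers $u_{H,\sigma}$ ($\sigma\in H^\sharp$) are defined by requiring, for every $\tau\in H^\sharp$, $\sum_{\sigma\in H^\sharp,\ \tau\mid\sigma} d(\tau,\sigma)\,u_{H,\sigma}=1$ (these determine the $u_{H,\sigma}$ by downward induction on divisibility). Functions on $G^\sharp$: for a subgroup $H\le G$, $\phi_{G/H}$ is the permutation character of $G$ on $G/H$ viewed as a function on $G^\sharp$, $\phi_G$ is the regular character, and $a_H=\phi_G-\phi_{G/H}$ (formal Artin character). For $\tau\in G^\sharp$, the tame character $a_\tau$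 is $a_H$ for $H$ the cyclic subgroup generated by an element of $C_\tau$. -}

module Defs where

open import Data.Bool using (Bool; true; false; if_then_else_; _∧_; not)
open import Data.Nat as ℕ using (ℕ; zero; suc)
open import Data.Nat.GCD using (gcd)
open import Data.Fin using (Fin; toℕ) renaming (_≟_ to _≟ᶠ_)
import Data.Fin as Fin
open import Data.Integer using (+_)
open import Data.Rational as ℚ using (ℚ; 0ℚ; 1ℚ; _+_; _*_; _-_; _÷_)
import Data.Rational.Properties as ℚP
open import Relation.Nullary using (yes; no)
open import Relation.Nullary.Decidable using (⌊_⌋)
open import Relation.Binary.PropositionalEquality using (_≡_)
open import Data.Product using (_×_)

∑ : ∀ {n} → (Fin n → ℚ) → ℚ
∑ {zero}  f = 0ℚ
∑ {suc n} f = f Fin.zero + ∑ (λ i → f (Fin.suc i))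

count : ∀ {n} → (Fin n → Bool) → ℕ
count {zero}  p = 0
count {suc n} p = (if p Fin.zero then 1 else 0) ℕ.+ count (λ i → p (Fin.suc i))

anyF : ∀ {n} → (Fin n → Bool) → Bool
anyF {zero}  p = false
anyF {suc n} p = if p Fin.zero then true else anyF (λ i → p (Fin.suc i))

anyUpTo : ℕ → (ℕ → Bool) → Bool
anyUpTo zero    p = p 0
anyUpTo (suc m) p = if p (suc m) then true else anyUpTo m p

-- least k ∈ {start, …, start+fuel-1} with p k (0 if none)
search : ℕ → ℕ → (ℕ → Bool) → ℕ
search zero       k p = 0
search (suc fuel) k p = if p k then k else search fuel (suc k) p

-- division of rationals; convention q = 0 ↦ 0 (never used with q = 0)
_÷'_ : ℚ → ℚ → ℚ
p ÷' q with q ℚP.≟ 0ℚ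
... | yes _  = 0ℚ
... | no q≢0 = _÷_ p q {{ℚ.≢-nonZero q≢0}}

fromℕ : ℕ → ℚ
fromℕ m = (+ m) ℚ./ 1

totient : ℕ → ℕ
totient m = count {m} (λ i → ⌊ gcd (suc (toℕ i)) m ℕ.≟ 1 ⌋)

record FinGroup : Set where
  field
    n     : ℕ
    _·_   : Fin n → Fin n → Fin n
    e     : Fin n
    inv   : Fin n → Fin n
    assoc : ∀ x y z → (x · y) · z ≡ x · (y · z)
    idˡ   : ∀ x → e · x ≡ x
    idʳ   : ∀ x → x · e ≡ x
    invˡ  : ∀ x → inv x · x ≡ e
    invʳ  : ∀ x → x · inv x ≡ e

record Subgroup (G : FinGroup) : Set where
  open FinGroup G
  field
    mem     : Fin n → Bool
    mem-e   : mem e ≡ true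
    mem-·   : ∀ x y → mem x ≡ true → mem y ≡ true → mem (x · y) ≡ true
    mem-inv : ∀ x → mem x ≡ true → mem (inv x) ≡ true

module GroupTheory (G : FinGroup) where
  open FinGroup G public

  _==_ : Fin n → Fin n → Bool
  x == y = ⌊ x ≟ᶠ y ⌋

  pow : Fin n → ℕ → Fin n
  pow x zero    = e
  pow x (suc k) = x · pow x k

  -- order of x: least k ≥ 1 with x^k = e (always ≤ |G| = n)
  ord : Fin n → ℕ
  ord x = search n 1 (λ k → pow x k == e)

  card : (Fin n → Bool) → ℕ
  card S = count S

  conj : (Fin n → Bool) → Fin n → Fin n → Bool
  conj S x y = anyF (λ g → S g ∧ (((g · x) · inv g) == y))

  conjPow : (Fin n → Bool) → Fin n → Fin n → Bool
  conjPow S x y = anyUpTo n (λ k → conj S x (pow y k))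

  pconj : (Fin n → Bool) → Fin n → Fin n → Bool
  pconj S x y = conjPow S x y ∧ conjPow S y x

  classSize : (Fin n → Bool) → Fin n → ℕ
  classSize S x = count (λ y → S y ∧ pconj S y x)

  bracket : (Fin n → Bool) → Fin n → ℚ
  bracket S x = fromℕ (classSize S x) ÷' fromℕ (totient (ord x))

  divs : (Fin n → Bool) → Fin n → Fin n → Bool
  divs S t s = anyF (λ s' → S s' ∧ pconj S s' s ∧ anyUpTo n (λ k → pconj S (pow s' k) t))

  dd : (Fin n → Bool) → Fin n → Fin n → ℚ
  dd S t s = bracket S s ÷' bracket S t

  -- Sum over the power-conjugacy classes σ of S satisfying P of F(σ),
  -- where P, F are given on representatives (and are class functions):
  -- each class σ is counted via its |C_σ| elements with weight 1/|C_σ|.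
  classSum : (Fin n → Bool) → (Fin n → Bool) → (Fin n → ℚ) → ℚ
  classSum S P F = ∑ (λ x → if S x ∧ P x then F x ÷' fromℕ (classSize S x) else 0ℚ)

  IsU : (Fin n → Bool) → (Fin n → ℚ) → Set
  IsU S u =
    (∀ x y → S x ≡ true → S y ≡ true → pconj S x y ≡ true → u x ≡ u y) ×
    (∀ t → S t ≡ true → classSum S (divs S t) (λ s → dd S t s * u s) ≡ 1ℚ)

  cyc : Fin n → Fin n → Bool
  cyc t y = anyUpTo n (λ k → pow t k == y)

  triv : Fin n → Bool
  triv y = y == e

  -- permutation character of G on G/H at g: number of cosets xH fixed by g,
  -- = #{x ∈ G : x⁻¹ g x ∈ H} / |H|
  permChar : (Fin n → Bool) → Fin n → ℚ
  permChar H g = fromℕ (count (λ x → H ((inv x · g) · x))) ÷' fromℕ (card H)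

  regChar : Fin n → ℚ
  regChar = permChar triv

  artin : (Fin n → Bool) → Fin n → ℚ
  artin H g = regChar g - permChar H g

  tame : Fin n → Fin n → ℚ
  tame t = artin (cyc t)

module Submission where

-- Write w(s) = u_σ / φ(σ̄) for s ∈ C_σ.  The heart of the proof is the identity of
-- functions on G
--   1_I = Σ_{s ∈ I} w(s) · 1_⟨s⟩,                                              (★)
-- proved by double counting.  Put A = Σ_{s ∈ I} w(s) · 1_⟨s⟩.  A is constant on
-- power-conjugacy classes, so Σ_{y ∈ C_τ} A(y) = A(t) |C_τ|; on the other hand C_τ meets
-- ⟨s⟩ exactly in the φ(τ̄) generators of the unique subgroup of ⟨s⟩ of order τ̄ when
-- τ ∣ σ, and not at all otherwise, so the same sum is φ(τ̄) Σ_{τ ∣ σ} w(s) = φ(τ̄) [τ] = |C_τ|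
-- by the defining system of u.  Evaluating (★) at the conjugates x⁻¹gx and summing over x
-- expresses φ_{G/I}(g) through the φ_{G/⟨s⟩}(g); since |⟨s⟩| = ord s and a_⟨e⟩ = 0 this
-- is the stated formula.

open import Defs
open import Data.Bool using (Bool; true; false; if_then_else_; _∧_; not; T)
open import Data.Bool.Properties using (∧-comm)
open import Data.Unit using (tt)
open import Data.Nat as ℕ using (ℕ; zero; suc; _≤_; _<_; z≤n; s≤s; NonZero)
import Data.Nat.Properties as ℕP
open import Data.Nat.DivMod using (_%_; _/_; m≡m%n+[m/n]*n; m%n<n)
open import Data.Nat.Divisibility using (_∣_; divides; ∣-antisym; m%n≡0⇒n∣m; *-cancelˡ-∣)
open import Data.Nat.GCD using (gcd)
import Data.Nat.GCD as GCD
open import Data.Nat.Coprimality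
  using (Coprime; coprime-Bézout; coprime-divisor; coprime⇒gcd≡1; gcd≡1⇒coprime; 1-coprimeTo)
  renaming (sym to coprime-sym)
open import Data.Nat.Tactic.RingSolver using (solve-∀)
open import Data.Fin as Fin using (Fin; toℕ)
import Data.Fin.Properties as FinP
import Data.Integer as ℤ
import Data.Integer.Properties as ℤP
open import Data.Rational as ℚ using (ℚ; 0ℚ; 1ℚ; _+_; _*_; _-_; mkℚ)
import Data.Rational.Properties as ℚP
open import Data.Rational.Solver using (module +-*-Solver)
open import Data.Product using (Σ-syntax; _×_; _,_; proj₁; proj₂)
open import Data.Sum using (inj₁; inj₂)
open import Function using (_∘_)
open import Relation.Nullary using (Dec; yes; no; ¬_; contradiction)
open import Relation.Nullary.Decidable using (⌊_⌋; isYes≗does; dec-true; dec-false; toWitness)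
open import Relation.Binary.PropositionalEquality

⌊⌋-intro : ∀ {A : Set} (a? : Dec A) → A → ⌊ a? ⌋ ≡ true
⌊⌋-intro a? a = trans (isYes≗does a?) (dec-true a? a)

⌊⌋-false : ∀ {A : Set} (a? : Dec A) → ¬ A → ⌊ a? ⌋ ≡ false
⌊⌋-false a? ¬a = trans (isYes≗does a?) (dec-false a? ¬a)

⌊⌋-elim : ∀ {A : Set} {a? : Dec A} → ⌊ a? ⌋ ≡ true → A
⌊⌋-elim eq = toWitness (subst T (sym eq) tt)

bool-ext : ∀ {a b : Bool} → (a ≡ true → b ≡ true) → (b ≡ true → a ≡ true) → a ≡ b
bool-ext {true}  {true}  _ _ = refl
bool-ext {true}  {false} f _ = sym (f refl)
bool-ext {false} {true}  _ g = g refl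
bool-ext {false} {false} _ _ = refl

∧-intro : ∀ {a b} → a ≡ true → b ≡ true → a ∧ b ≡ true
∧-intro refl refl = refl

∧-elimˡ : ∀ {a b} → a ∧ b ≡ true → a ≡ true
∧-elimˡ {true} _ = refl

∧-elimʳ : ∀ {a b} → a ∧ b ≡ true → b ≡ true
∧-elimʳ {true} h = h

fromℕ≡mkℚ : ∀ m → fromℕ m ≡ mkℚ (ℤ.+ m) 0 (coprime-sym (1-coprimeTo m))
fromℕ≡mkℚ m = ℚP.normalize-coprime (coprime-sym (1-coprimeTo m))

fromℕ-suc : ∀ m → fromℕ (suc m) ≡ 1ℚ + fromℕ m
fromℕ-suc m rewrite fromℕ≡mkℚ m = cong (λ z → (ℤ.+ 1 ℤ.+ z) ℚ./ 1) (sym (ℤP.*-identityʳ (ℤ.+ m)))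

fromℕ-suc≢0 : ∀ m → fromℕ (suc m) ≢ 0ℚ
fromℕ-suc≢0 m eq with trans (sym (fromℕ≡mkℚ (suc m))) eq
... | ()

-- The reciprocal used by the division _÷'_ of the definitions.  It is opaque so that
-- the type checker never unfolds it into rational normalisation.
opaque
  recip : ℚ → ℚ
  recip q = 1ℚ ÷' q

  ÷'≡*recip : ∀ p q → p ÷' q ≡ p * recip q
  ÷'≡*recip p q with q ℚP.≟ 0ℚ
  ... | yes _ = sym (ℚP.*-zeroʳ p)
  ... | no _  = cong (p *_) (sym (ℚP.*-identityˡ _))

  *-recip : ∀ q → q ≢ 0ℚ → q * recip q ≡ 1ℚ
  *-recip q q≢0 with q ℚP.≟ 0ℚ
  ... | yes q≡0 = contradiction q≡0 q≢0
  ... | no q≢0′ = trans (cong (q *_) (ℚP.*-identityˡ _)) (ℚP.*-inverseʳ q {{ℚ.≢-nonZero q≢0′}})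

recip-def : ∀ q → 1ℚ ÷' q ≡ recip q
recip-def q = trans (÷'≡*recip 1ℚ q) (ℚP.*-identityˡ (recip q))

÷'≢0 : ∀ p q → p ≢ 0ℚ → q ≢ 0ℚ → p ÷' q ≢ 0ℚ
÷'≢0 p q p≢0 q≢0 p÷q≡0 = p≢0 (begin
  p                  ≡⟨ ℚP.*-identityʳ p ⟨
  p * 1ℚ             ≡⟨ cong (p *_) (*-recip q q≢0) ⟨
  p * (q * recip q)  ≡⟨ cong (p *_) (ℚP.*-comm q (recip q)) ⟩
  p * (recip q * q)  ≡⟨ ℚP.*-assoc p (recip q) q ⟨
  (p * recip q) * q  ≡⟨ cong (_* q) (trans (sym (÷'≡*recip p q)) p÷q≡0) ⟩
  0ℚ * q             ≡⟨ ℚP.*-zeroˡ q ⟩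
  0ℚ                 ∎)
  where open ≡-Reasoning

recip-solve : ∀ b x → b ≢ 0ℚ → recip b * x ≡ 1ℚ → x ≡ b
recip-solve b x b≢0 eq = begin
  x                  ≡⟨ ℚP.*-identityˡ x ⟨
  1ℚ * x             ≡⟨ cong (_* x) (*-recip b b≢0) ⟨
  (b * recip b) * x  ≡⟨ ℚP.*-assoc b (recip b) x ⟩
  b * (recip b * x)  ≡⟨ cong (b *_) eq ⟩
  b * 1ℚ             ≡⟨ ℚP.*-identityʳ b ⟩
  b                  ∎
  where open ≡-Reasoning

*-cancel-to-1 : ∀ a c → c ≢ 0ℚ → a * c ≡ c → a ≡ 1ℚ
*-cancel-to-1 a c c≢0 eq = begin
  a                  ≡⟨ ℚP.*-identityʳ a ⟨
  a * 1ℚ             ≡⟨ cong (a *_) (*-recip c c≢0) ⟨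
  a * (c * recip c)  ≡⟨ ℚP.*-assoc a c (recip c) ⟨
  (a * c) * recip c  ≡⟨ cong (_* recip c) eq ⟩
  c * recip c        ≡⟨ *-recip c c≢0 ⟩
  1ℚ                 ∎
  where open ≡-Reasoning

∑-cong : ∀ {m} {f g : Fin m → ℚ} → (∀ i → f i ≡ g i) → ∑ f ≡ ∑ g
∑-cong {zero}  h = refl
∑-cong {suc m} h = cong₂ _+_ (h Fin.zero) (∑-cong (λ i → h (Fin.suc i)))

∑-zero : ∀ {m} (f : Fin m → ℚ) → (∀ i → f i ≡ 0ℚ) → ∑ f ≡ 0ℚ
∑-zero {zero}  f h = refl
∑-zero {suc m} f h = cong₂ _+_ (h Fin.zero) (∑-zero (λ i → f (Fin.suc i)) (λ i → h (Fin.suc i)))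

∑-+ : ∀ {m} (f g : Fin m → ℚ) → ∑ (λ i → f i + g i) ≡ ∑ f + ∑ g
∑-+ {zero}  f g = refl
∑-+ {suc m} f g =
  trans (cong ((f Fin.zero + g Fin.zero) +_) (∑-+ (λ i → f (Fin.suc i)) (λ i → g (Fin.suc i))))
        (interchange (f Fin.zero) (g Fin.zero) _ _)
  where
  open +-*-Solver
  interchange : ∀ a b c d → (a + b) + (c + d) ≡ (a + c) + (b + d)
  interchange = solve 4 (λ a b c d → (a :+ b) :+ (c :+ d) := (a :+ c) :+ (b :+ d)) refl

∑-sub : ∀ {m} (f g : Fin m → ℚ) → ∑ (λ i → f i - g i) ≡ ∑ f - ∑ g
∑-sub {zero}  f g = refl
∑-sub {suc m} f g =
  trans (cong ((f Fin.zero - g Fin.zero) +_) (∑-sub (λ i → f (Fin.suc i)) (λ i → g (Fin.suc i))))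
        (interchange (f Fin.zero) (g Fin.zero) _ _)
  where
  open +-*-Solver
  interchange : ∀ a b c d → (a - b) + (c - d) ≡ (a + c) - (b + d)
  interchange = solve 4 (λ a b c d → (a :- b) :+ (c :- d) := (a :+ c) :- (b :+ d)) refl

∑-*ˡ : ∀ {m} (c : ℚ) (f : Fin m → ℚ) → ∑ (λ i → c * f i) ≡ c * ∑ f
∑-*ˡ {zero}  c f = sym (ℚP.*-zeroʳ c)
∑-*ˡ {suc m} c f = trans (cong (c * f Fin.zero +_) (∑-*ˡ c (λ i → f (Fin.suc i))))
                         (sym (ℚP.*-distribˡ-+ c (f Fin.zero) _))

∑-swap : ∀ {m k} (f : Fin m → Fin k → ℚ) → ∑ (λ i → ∑ (f i)) ≡ ∑ (λ j → ∑ (λ i → f i j))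
∑-swap {zero}  {k} f = sym (∑-zero {k} (λ _ → 0ℚ) (λ _ → refl))
∑-swap {suc m} {k} f = trans (cong (∑ (f Fin.zero) +_) (∑-swap (λ i → f (Fin.suc i))))
                             (sym (∑-+ (f Fin.zero) (λ j → ∑ (λ i → f (Fin.suc i) j))))

∑-single : ∀ {m} (f : Fin m → ℚ) (a : Fin m) → (∀ i → i ≢ a → f i ≡ 0ℚ) → ∑ f ≡ f a
∑-single {suc m} f Fin.zero h =
  trans (cong (f Fin.zero +_) (∑-zero _ (λ i → h (Fin.suc i) (λ ())))) (ℚP.+-identityʳ _)
∑-single {suc m} f (Fin.suc a) h =
  trans (cong₂ _+_ (h Fin.zero (λ ()))
                   (∑-single (λ i → f (Fin.suc i)) a (λ i i≢a → h (Fin.suc i) (i≢a ∘ FinP.suc-injective))))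
        (ℚP.+-identityˡ _)

∑-const : ∀ {m} (c : ℚ) → ∑ {m} (λ _ → c) ≡ fromℕ m * c
∑-const {zero}  c = sym (ℚP.*-zeroˡ c)
∑-const {suc m} c = trans (cong (c +_) (∑-const {m} c))
                          (trans (distrib c (fromℕ m)) (cong (_* c) (sym (fromℕ-suc m))))
  where
  open +-*-Solver
  distrib : ∀ c x → c + x * c ≡ (1ℚ + x) * c
  distrib = solve 2 (λ c x → c :+ x :* c := (con 1ℚ :+ x) :* c) refl

𝟙 : Bool → ℚ
𝟙 b = if b then 1ℚ else 0ℚ

count≡∑𝟙 : ∀ {m} (p : Fin m → Bool) → fromℕ (count p) ≡ ∑ (λ i → 𝟙 (p i))
count≡∑𝟙 {zero}  p = refl
count≡∑𝟙 {suc m} p with p Fin.zero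
... | true  = trans (fromℕ-suc (count (λ i → p (Fin.suc i)))) (cong (1ℚ +_) (count≡∑𝟙 (λ i → p (Fin.suc i))))
... | false = trans (count≡∑𝟙 (λ i → p (Fin.suc i))) (sym (ℚP.+-identityˡ _))

count-cong : ∀ {m} {p q : Fin m → Bool} → (∀ i → p i ≡ q i) → count p ≡ count q
count-cong {zero}  h = refl
count-cong {suc m} h = cong₂ ℕ._+_ (cong (if_then 1 else 0) (h Fin.zero)) (count-cong (λ i → h (Fin.suc i)))

count≢0 : ∀ {m} (p : Fin m → Bool) a → p a ≡ true → fromℕ (count p) ≢ 0ℚ
count≢0 {suc m} p a pa with p Fin.zero in p0
... | true = fromℕ-suc≢0 (count (λ i → p (Fin.suc i)))
count≢0 {suc m} p Fin.zero     pa | false = contradiction (trans (sym pa) p0) λ ()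
count≢0 {suc m} p (Fin.suc a)  pa | false = count≢0 (λ i → p (Fin.suc i)) a pa

-- φ(m) ≥ 1 for m ≥ 1, since 1 is a unit
totient≢0 : ∀ m → 1 ≤ m → fromℕ (totient m) ≢ 0ℚ
totient≢0 (suc m) _ = count≢0 {suc m} (λ i → ⌊ gcd (suc (toℕ i)) (suc m) ℕ.≟ 1 ⌋) Fin.zero
                              (⌊⌋-intro (gcd 1 (suc m) ℕ.≟ 1) (coprime⇒gcd≡1 (1-coprimeTo (suc m))))

if-cong : ∀ b {x y : ℚ} → (b ≡ true → x ≡ y) → (if b then x else 0ℚ) ≡ (if b then y else 0ℚ)
if-cong true  h = h refl
if-cong false h = refl

if-*ˡ : ∀ b (c x : ℚ) → c * (if b then x else 0ℚ) ≡ (if b then c * x else 0ℚ)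
if-*ˡ true  c x = refl
if-*ˡ false c x = ℚP.*-zeroʳ c

if-true : ∀ (x : ℚ) → x ≡ (if true then x else 0ℚ)
if-true x = refl

if-0 : ∀ b → (if b then 0ℚ else 0ℚ) ≡ 0ℚ
if-0 true  = refl
if-0 false = refl

if-𝟙 : ∀ a b → (if a then 𝟙 b else 0ℚ) ≡ 𝟙 (a ∧ b)
if-𝟙 true  b = refl
if-𝟙 false b = refl

if≡*𝟙 : ∀ b (x : ℚ) → (if b then x else 0ℚ) ≡ x * 𝟙 b
if≡*𝟙 true  x = sym (ℚP.*-identityʳ x)
if≡*𝟙 false x = sym (ℚP.*-zeroʳ x)

∑-if : ∀ {m} b (f : Fin m → ℚ) → ∑ (λ i → if b then f i else 0ℚ) ≡ (if b then ∑ f else 0ℚ)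
∑-if true  f = refl
∑-if {m} false f = ∑-zero {m} (λ _ → 0ℚ) (λ _ → refl)

∑-reindex : ∀ {m k} (E : Fin k → Fin m) → (∀ {i j} → E i ≡ E j → i ≡ j)
  → (P : Fin m → Bool) → (∀ y → P y ≡ true → Σ[ i ∈ Fin k ] E i ≡ y) → (∀ i → P (E i) ≡ true)
  → (h : Fin m → ℚ) → ∑ (λ y → if P y then h y else 0ℚ) ≡ ∑ (λ i → h (E i))
∑-reindex {m} {k} E E-inj P E-onto E-into h =
  trans (∑-cong as-double) (trans (∑-swap δ) (∑-cong pick))
  where
  δ : Fin m → Fin k → ℚ
  δ y i = if ⌊ E i Fin.≟ y ⌋ then h y else 0ℚ
  δ-off : ∀ {y i} → E i ≢ y → δ y i ≡ 0ℚ
  δ-off {y} {i} ne = cong (λ b → if b then h y else 0ℚ) (⌊⌋-false (E i Fin.≟ y) ne)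
  δ-on : ∀ i → δ (E i) i ≡ h (E i)
  δ-on i = cong (λ b → if b then h (E i) else 0ℚ) (⌊⌋-intro (E i Fin.≟ E i) refl)
  outside : ∀ {y} i → P y ≡ false → E i ≢ y
  outside i Py Ei≡y = contradiction (trans (sym (E-into i)) (trans (cong P Ei≡y) Py)) λ ()
  as-double : ∀ y → (if P y then h y else 0ℚ) ≡ ∑ (δ y)
  as-double y with P y in Py
  ... | false = sym (∑-zero (δ y) (λ i → δ-off (outside i Py)))
  ... | true with E-onto y Py
  ...   | i₀ , refl =
    sym (trans (∑-single (δ (E i₀)) i₀ (λ i i≢i₀ → δ-off (i≢i₀ ∘ E-inj))) (δ-on i₀))
  pick : ∀ i → ∑ (λ y → δ y i) ≡ h (E i)
  pick i = trans (∑-single (λ y → δ y i) (E i) (λ y y≢Ei → δ-off (y≢Ei ∘ sym))) (δ-on i)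

∑-permute : ∀ {m} (π : Fin m → Fin m) → (∀ {i j} → π i ≡ π j → i ≡ j) → (∀ j → Σ[ i ∈ Fin m ] π i ≡ j)
  → (f : Fin m → ℚ) → ∑ (λ i → f (π i)) ≡ ∑ f
∑-permute π π-inj π-onto f = sym (∑-reindex π π-inj (λ _ → true) (λ j _ → π-onto j) (λ _ → refl) f)

anyUpTo-intro : ∀ m (p : ℕ → Bool) {k} → k ≤ m → p k ≡ true → anyUpTo m p ≡ true
anyUpTo-intro zero    p z≤n pk = pk
anyUpTo-intro (suc m) p {k} k≤1+m pk with p (suc m) in p[1+m]
... | true  = refl
... | false with ℕP.m≤n⇒m<n∨m≡n k≤1+m
...   | inj₁ k<1+m = anyUpTo-intro m p (ℕP.≤-pred k<1+m) pk
...   | inj₂ refl  = contradiction (trans (sym pk) p[1+m]) λ ()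

anyUpTo-elim : ∀ m (p : ℕ → Bool) → anyUpTo m p ≡ true → Σ[ k ∈ ℕ ] (k ≤ m × p k ≡ true)
anyUpTo-elim zero    p h = 0 , z≤n , h
anyUpTo-elim (suc m) p h with p (suc m) in p[1+m]
... | true  = suc m , ℕP.≤-refl , p[1+m]
... | false with anyUpTo-elim m p h
...   | k , k≤m , pk = k , ℕP.m≤n⇒m≤1+n k≤m , pk

anyF-intro : ∀ {m} (p : Fin m → Bool) i → p i ≡ true → anyF p ≡ true
anyF-intro {suc m} p i pi with p Fin.zero in p0
... | true = refl
anyF-intro {suc m} p Fin.zero    pi | false = contradiction (trans (sym pi) p0) λ ()
anyF-intro {suc m} p (Fin.suc i) pi | false = anyF-intro (λ j → p (Fin.suc j)) i pi

anyF-elim : ∀ {m} (p : Fin m → Bool) → anyF p ≡ true → Σ[ i ∈ Fin m ] p i ≡ true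
anyF-elim {suc m} p h with p Fin.zero in p0
... | true = Fin.zero , p0
... | false with anyF-elim (λ j → p (Fin.suc j)) h
...   | i , pi = Fin.suc i , pi

record Least (p : ℕ → Bool) (k j r : ℕ) : Set where
  field
    holds : p r ≡ true
    above : k ≤ r
    below : r ≤ j
    least : ∀ i → k ≤ i → i < r → p i ≡ false

search-least : ∀ fuel k (p : ℕ → Bool) {j} → k ≤ j → j < k ℕ.+ fuel → p j ≡ true
  → Least p k j (search fuel k p)
search-least zero k p k≤j j<k+0 pj =
  contradiction (subst (_ <_) (ℕP.+-identityʳ k) j<k+0) (ℕP.≤⇒≯ k≤j)
search-least (suc fuel) k p {j} k≤j j<k+fuel pj with p k in pk
... | true = record { holds = pk ; above = ℕP.≤-refl ; below = k≤j
                    ; least = λ i k≤i i<k → contradiction i<k (ℕP.≤⇒≯ k≤i) }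
... | false = record { holds = holds ; above = ℕP.<⇒≤ above ; below = below ; least = least′ }
  where
  k<j : k < j
  k<j = ℕP.≤∧≢⇒< k≤j (λ k≡j → contradiction (trans (sym pj) (trans (cong p (sym k≡j)) pk)) λ ())
  open Least (search-least fuel (suc k) p k<j (subst (j <_) (ℕP.+-suc k fuel) j<k+fuel) pj)
  least′ : ∀ i → k ≤ i → i < search fuel (suc k) p → p i ≡ false
  least′ i k≤i i<r with ℕP.m≤n⇒m<n∨m≡n k≤i
  ... | inj₁ k<i = least i k<i i<r
  ... | inj₂ refl = pk

module GroupFacts (G : FinGroup) where
  open GroupTheory G

  ==-elim : ∀ {x y} → (x == y) ≡ true → x ≡ y
  ==-elim = ⌊⌋-elim

  ==-intro : ∀ {x y} → x ≡ y → (x == y) ≡ true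
  ==-intro {x} {y} = ⌊⌋-intro (x Fin.≟ y)

  cancelˡ : ∀ {x y z} → x · y ≡ x · z → y ≡ z
  cancelˡ {x} {y} {z} eq = begin
    y                ≡⟨ sym (idˡ y) ⟩
    e · y            ≡⟨ cong (_· y) (sym (invˡ x)) ⟩
    (inv x · x) · y  ≡⟨ assoc _ _ _ ⟩
    inv x · (x · y)  ≡⟨ cong (inv x ·_) eq ⟩
    inv x · (x · z)  ≡⟨ sym (assoc _ _ _) ⟩
    (inv x · x) · z  ≡⟨ cong (_· z) (invˡ x) ⟩
    e · z            ≡⟨ idˡ z ⟩
    z                ∎
    where open ≡-Reasoning

  inv-unique : ∀ {x y} → x · y ≡ e → y ≡ inv x
  inv-unique {x} eq = cancelˡ (trans eq (sym (invʳ x)))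

  inv-e : inv e ≡ e
  inv-e = sym (inv-unique (idˡ e))

  inv-inv : ∀ x → inv (inv x) ≡ x
  inv-inv x = sym (inv-unique (invˡ x))

  inv-· : ∀ x y → inv (x · y) ≡ inv y · inv x
  inv-· x y = sym (inv-unique (begin
    (x · y) · (inv y · inv x)  ≡⟨ assoc _ _ _ ⟩
    x · (y · (inv y · inv x))  ≡⟨ cong (x ·_) (sym (assoc _ _ _)) ⟩
    x · ((y · inv y) · inv x)  ≡⟨ cong (λ z → x · (z · inv x)) (invʳ y) ⟩
    x · (e · inv x)            ≡⟨ cong (x ·_) (idˡ _) ⟩
    x · inv x                  ≡⟨ invʳ x ⟩
    e                          ∎))
    where open ≡-Reasoning

  pow-+ : ∀ x a b → pow x (a ℕ.+ b) ≡ pow x a · pow x b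
  pow-+ x zero    b = sym (idˡ _)
  pow-+ x (suc a) b = trans (cong (x ·_) (pow-+ x a b)) (sym (assoc _ _ _))

  pow-* : ∀ x a b → pow x (b ℕ.* a) ≡ pow (pow x a) b
  pow-* x a zero    = refl
  pow-* x a (suc b) = trans (pow-+ x a (b ℕ.* a)) (cong (pow x a ·_) (pow-* x a b))

  pow-1 : ∀ x → pow x 1 ≡ x
  pow-1 = idʳ

  pow-e : ∀ k → pow e k ≡ e
  pow-e zero    = refl
  pow-e (suc k) = trans (idˡ _) (pow-e k)

  pow-cancel : ∀ x {a b} → a ≤ b → pow x a ≡ pow x b → pow x (b ℕ.∸ a) ≡ e
  pow-cancel x {a} {b} a≤b eq = cancelˡ (begin
    pow x a · pow x (b ℕ.∸ a)  ≡⟨ sym (pow-+ x a _) ⟩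
    pow x (a ℕ.+ (b ℕ.∸ a))    ≡⟨ cong (pow x) (ℕP.m+[n∸m]≡n a≤b) ⟩
    pow x b                    ≡⟨ sym eq ⟩
    pow x a                    ≡⟨ sym (idʳ _) ⟩
    pow x a · e                ∎)
    where open ≡-Reasoning

  cj : Fin n → Fin n → Fin n
  cj g x = (g · x) · inv g

  cj-· : ∀ g x y → cj g (x · y) ≡ cj g x · cj g y
  cj-· g x y = begin
    (g · (x · y)) · inv g                  ≡⟨ cong (_· inv g) (sym (assoc _ _ _)) ⟩
    ((g · x) · y) · inv g                  ≡⟨ cong (λ z → ((g · x) · z) · inv g) (sym (idˡ y)) ⟩
    ((g · x) · (e · y)) · inv g            ≡⟨ cong (λ z → ((g · x) · (z · y)) · inv g) (sym (invˡ g)) ⟩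
    ((g · x) · ((inv g · g) · y)) · inv g  ≡⟨ cong (λ z → ((g · x) · z) · inv g) (assoc _ _ _) ⟩
    ((g · x) · (inv g · (g · y))) · inv g  ≡⟨ cong (_· inv g) (sym (assoc _ _ _)) ⟩
    (((g · x) · inv g) · (g · y)) · inv g  ≡⟨ assoc _ _ _ ⟩
    ((g · x) · inv g) · ((g · y) · inv g)  ∎
    where open ≡-Reasoning

  cj-e : ∀ g → cj g e ≡ e
  cj-e g = trans (cong (_· inv g) (idʳ g)) (invʳ g)

  cj-pow : ∀ g x k → cj g (pow x k) ≡ pow (cj g x) k
  cj-pow g x zero    = cj-e g
  cj-pow g x (suc k) = trans (cj-· g x (pow x k)) (cong (cj g x ·_) (cj-pow g x k))

  cj-comp : ∀ g h x → cj g (cj h x) ≡ cj (g · h) x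
  cj-comp g h x = begin
    (g · ((h · x) · inv h)) · inv g  ≡⟨ cong (_· inv g) (sym (assoc _ _ _)) ⟩
    ((g · (h · x)) · inv h) · inv g  ≡⟨ assoc _ _ _ ⟩
    (g · (h · x)) · (inv h · inv g)  ≡⟨ cong₂ _·_ (sym (assoc _ _ _)) (sym (inv-· g h)) ⟩
    ((g · h) · x) · inv (g · h)      ∎
    where open ≡-Reasoning

  cj-id : ∀ x → cj e x ≡ x
  cj-id x = trans (cong₂ _·_ (idˡ x) inv-e) (idʳ x)

  cj-invˡ : ∀ g x → cj (inv g) (cj g x) ≡ x
  cj-invˡ g x = trans (cj-comp _ _ _) (trans (cong (λ z → cj z x) (invˡ g)) (cj-id x))

  cj-invʳ : ∀ g x → cj g (cj (inv g) x) ≡ x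
  cj-invʳ g x = trans (cj-comp _ _ _) (trans (cong (λ z → cj z x) (invʳ g)) (cj-id x))

  cj-injective : ∀ g {x y} → cj g x ≡ cj g y → x ≡ y
  cj-injective g {x} {y} eq = trans (sym (cj-invˡ g x)) (trans (cong (cj (inv g)) eq) (cj-invˡ g y))

  -- Pigeonhole: among x⁰, …, xⁿ two powers agree, so some 1 ≤ d ≤ n has x^d = e.
  period : ∀ x → Σ[ d ∈ ℕ ] (1 ≤ d) × (d ≤ n) × (pow x d ≡ e)
  period x with FinP.pigeonhole (ℕP.n<1+n n) (λ (i : Fin (suc n)) → pow x (toℕ i))
  ... | i , j , i<j , eq =
    toℕ j ℕ.∸ toℕ i , ℕP.m<n⇒0<n∸m i<j ,
    ℕP.≤-trans (ℕP.m∸n≤m (toℕ j) (toℕ i)) (ℕP.≤-pred (FinP.toℕ<n j)) ,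
    pow-cancel x (ℕP.<⇒≤ i<j) eq

  ord-least : ∀ x → Least (λ k → pow x k == e) 1 n (ord x)
  ord-least x with period x
  ... | d , 1≤d , d≤n , xᵈ≡e =
    record { holds = holds ; above = above ; below = ℕP.≤-trans below d≤n ; least = least }
    where open Least (search-least n 1 (λ k → pow x k == e) 1≤d (s≤s d≤n) (==-intro xᵈ≡e))

  instance
    ord-nonZero : ∀ {x} → NonZero (ord x)
    ord-nonZero {x} = ℕ.>-nonZero (Least.above (ord-least x))

  ord-pos : ∀ x → 1 ≤ ord x
  ord-pos x = Least.above (ord-least x)

  ord-≤n : ∀ x → ord x ≤ n
  ord-≤n x = Least.below (ord-least x)

  pow-ord : ∀ x → pow x (ord x) ≡ e
  pow-ord x = ==-elim (Least.holds (ord-least x))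

  ord-minimal : ∀ x {i} → 1 ≤ i → i < ord x → pow x i ≢ e
  ord-minimal x {i} 1≤i i<ord xⁱ≡e =
    contradiction (trans (sym (==-intro xⁱ≡e)) (Least.least (ord-least x) i 1≤i i<ord)) λ ()

  ord∣⇒pow≡e : ∀ x k → ord x ∣ k → pow x k ≡ e
  ord∣⇒pow≡e x _ (divides q refl) =
    trans (pow-* x (ord x) q) (trans (cong (λ z → pow z q) (pow-ord x)) (pow-e q))

  pow-mod : ∀ x k → pow x k ≡ pow x (k % ord x)
  pow-mod x k = begin
    pow x k                                          ≡⟨ cong (pow x) (m≡m%n+[m/n]*n k (ord x)) ⟩
    pow x (k % ord x ℕ.+ k / ord x ℕ.* ord x)        ≡⟨ pow-+ x (k % ord x) _ ⟩
    pow x (k % ord x) · pow x (k / ord x ℕ.* ord x)  ≡⟨ cong (pow x (k % ord x) ·_) xᵐ≡e ⟩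
    pow x (k % ord x) · e                            ≡⟨ idʳ _ ⟩
    pow x (k % ord x)                                ∎
    where
    open ≡-Reasoning
    xᵐ≡e : pow x (k / ord x ℕ.* ord x) ≡ e
    xᵐ≡e = ord∣⇒pow≡e x _ (divides (k / ord x) refl)

  pow≡e⇒ord∣ : ∀ x k → pow x k ≡ e → ord x ∣ k
  pow≡e⇒ord∣ x k xᵏ≡e with k % ord x in k%ord
  ... | zero   = m%n≡0⇒n∣m k (ord x) k%ord
  ... | suc r  = contradiction (trans (cong (pow x) (sym k%ord)) (trans (sym (pow-mod x k)) xᵏ≡e))
                               (ord-minimal x (s≤s z≤n) (subst (_< ord x) k%ord (m%n<n k (ord x))))

  ord-unique : ∀ x d → pow x d ≡ e → (∀ k → pow x k ≡ e → d ∣ k) → ord x ≡ d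
  ord-unique x d xᵈ≡e d∣ = ∣-antisym (pow≡e⇒ord∣ x d xᵈ≡e) (d∣ (ord x) (pow-ord x))

  ord-e : ord e ≡ 1
  ord-e = ord-unique e 1 (idʳ e) (λ k _ → divides k (sym (ℕP.*-identityʳ k)))

  ord-cj : ∀ g x → ord (cj g x) ≡ ord x
  ord-cj g x = ord-unique (cj g x) (ord x)
    (trans (sym (cj-pow g x (ord x))) (trans (cong (cj g) (pow-ord x)) (cj-e g)))
    (λ k eq → pow≡e⇒ord∣ x k (cj-injective g (trans (cj-pow g x k) (trans eq (sym (cj-e g))))))

  ord-pow∣ord : ∀ x a → ord (pow x a) ∣ ord x
  ord-pow∣ord x a = pow≡e⇒ord∣ (pow x a) (ord x)
    (trans (sym (pow-* x a (ord x))) (ord∣⇒pow≡e x _ (divides a (ℕP.*-comm (ord x) a))))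

  below-ord : ∀ x {d} → d < ord x → pow x d ≡ e → d ≡ 0
  below-ord x {zero}  _     _    = refl
  below-ord x {suc d} d<ord xᵈ≡e = contradiction xᵈ≡e (ord-minimal x (s≤s z≤n) d<ord)

  pow-injective-≤ : ∀ x {a b} → a ≤ b → b < ord x → pow x a ≡ pow x b → a ≡ b
  pow-injective-≤ x {a} {b} a≤b b<ord eq = ℕP.≤-antisym a≤b
    (ℕP.m∸n≡0⇒m≤n (below-ord x (ℕP.≤-<-trans (ℕP.m∸n≤m b a) b<ord) (pow-cancel x a≤b eq)))

  pow-injective : ∀ x {a b} → a < ord x → b < ord x → pow x a ≡ pow x b → a ≡ b
  pow-injective x {a} {b} a<ord b<ord eq with ℕP.≤-total a b
  ... | inj₁ a≤b = pow-injective-≤ x a≤b b<ord eq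
  ... | inj₂ b≤a = sym (pow-injective-≤ x b≤a a<ord (sym eq))

  ord-pow-coprime : ∀ x j → Coprime (ord x) j → ord (pow x j) ≡ ord x
  ord-pow-coprime x j cop = ord-unique (pow x j) (ord x)
    (trans (sym (pow-* x j (ord x))) (ord∣⇒pow≡e x _ (divides j (ℕP.*-comm (ord x) j))))
    (λ k eq → coprime-divisor cop (subst (ord x ∣_) (ℕP.*-comm k j)
                (pow≡e⇒ord∣ x _ (trans (pow-* x j k) eq))))

  -- ... and only then: a common divisor i of j and m = q·i = ord x gives (x^j)^q = e,
  -- so m ∣ q ∣ m, hence q = m and i = 1.
  ord-pow≡⇒coprime : ∀ x j → ord (pow x j) ≡ ord x → Coprime j (ord x)
  ord-pow≡⇒coprime x j ord≡ {i} (divides a refl , divides q m≡q*i) =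
    ℕP.*-cancelˡ-≡ i 1 q {{q-nonZero}} (trans (sym m≡q*i) (trans m≡q (sym (ℕP.*-identityʳ q))))
    where
    m : ℕ
    m = ord x
    xʲ^q≡e : pow (pow x (a ℕ.* i)) q ≡ e
    xʲ^q≡e = trans (sym (pow-* x (a ℕ.* i) q))
               (ord∣⇒pow≡e x _ (divides a (trans (reorder q a i) (cong (a ℕ.*_) (sym m≡q*i)))))
      where
      reorder : ∀ q a i → q ℕ.* (a ℕ.* i) ≡ a ℕ.* (q ℕ.* i)
      reorder = solve-∀
    m≡q : m ≡ q
    m≡q = ∣-antisym (subst (_∣ q) ord≡ (pow≡e⇒ord∣ _ q xʲ^q≡e))
                    (divides i (trans m≡q*i (ℕP.*-comm q i)))
    q-nonZero : NonZero q
    q-nonZero = subst NonZero m≡q ord-nonZero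

  inv-as-pow : ∀ w → pow w (ord w ℕ.∸ 1) ≡ inv w
  inv-as-pow w = inv-unique (trans (cong (pow w) (ℕP.m+[n∸m]≡n (ord-pos w))) (pow-ord w))

  coprime⇒generates : ∀ x j → Coprime j (ord x) → Σ[ c ∈ ℕ ] pow (pow x j) c ≡ x
  coprime⇒generates x j cop with coprime-Bézout cop
  ... | GCD.Bézout.+- X Y 1+Ym≡Xj = X , (begin
    pow (pow x j) X             ≡⟨ sym (pow-* x j X) ⟩
    pow x (X ℕ.* j)             ≡⟨ cong (pow x) (sym 1+Ym≡Xj) ⟩
    x · pow x (Y ℕ.* ord x)     ≡⟨ cong (x ·_) (ord∣⇒pow≡e x _ (divides Y refl)) ⟩
    x · e                       ≡⟨ idʳ x ⟩
    x                           ∎)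
    where open ≡-Reasoning
  ... | GCD.Bézout.-+ X Y 1+Xj≡Ym = (ord z ℕ.∸ 1) ℕ.* X , (begin
    pow (pow x j) ((ord z ℕ.∸ 1) ℕ.* X)  ≡⟨ pow-* (pow x j) X (ord z ℕ.∸ 1) ⟩
    pow z (ord z ℕ.∸ 1)                  ≡⟨ inv-as-pow z ⟩
    inv z                                ≡⟨ cong inv (inv-unique x·z≡e) ⟩
    inv (inv x)                          ≡⟨ inv-inv x ⟩
    x                                    ∎)
    where
    open ≡-Reasoning
    z = pow (pow x j) X
    -- x · (x^j)^X = x^(1 + X j) = x^(Y ord x) = e
    x·z≡e : x · z ≡ e
    x·z≡e = trans (cong (x ·_) (sym (pow-* x j X)))
              (trans (cong (pow x) 1+Xj≡Ym) (ord∣⇒pow≡e x _ (divides Y refl)))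

  -- ⟨s⟩ has one subgroup of each order: with m = ord s = q · ord t for t = s^b,
  -- the powers of s killed by ord t are exactly those of w = s^q; t generates ⟨w⟩,
  -- so every s^a of the same order as t is a power of t.
  same-order⇒power : ∀ s a b → ord (pow s a) ≡ ord (pow s b) → Σ[ c ∈ ℕ ] pow (pow s b) c ≡ pow s a
  same-order⇒power s a b ord≡ with ord-pow∣ord s b
  ... | divides q m≡q*d = a′ ℕ.* c , (begin
    pow t (a′ ℕ.* c)           ≡⟨ pow-* t c a′ ⟩
    pow (pow t c) a′           ≡⟨ cong (λ z → pow (pow z c) a′) (sym w^b′≡t) ⟩
    pow (pow (pow w b′) c) a′  ≡⟨ cong (λ z → pow z a′) w≡ ⟩
    pow w a′                   ≡⟨ w^a′≡s^a ⟩
    pow s a                    ∎)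
    where
    open ≡-Reasoning
    t w : Fin n
    t = pow s b
    w = pow s q
    d : ℕ
    d = ord t
    instance
      q-nonZero : NonZero q
      q-nonZero = ℕP.m*n≢0⇒m≢0 q {{subst NonZero m≡q*d ord-nonZero}}
    ord-w : ord w ≡ d
    ord-w = ord-unique w d
      (trans (sym (pow-* s q d)) (trans (cong (pow s) (trans (ℕP.*-comm d q) (sym m≡q*d))) (pow-ord s)))
      (λ k wᵏ≡e → *-cancelˡ-∣ q (subst₂ _∣_ m≡q*d (ℕP.*-comm k q)
                    (pow≡e⇒ord∣ s (k ℕ.* q) (trans (pow-* s q k) wᵏ≡e))))
    in-⟨w⟩ : ∀ r → pow (pow s r) d ≡ e → Σ[ r′ ∈ ℕ ] pow w r′ ≡ pow s r
    in-⟨w⟩ r eq with *-cancelˡ-∣ d (subst (_∣ d ℕ.* r) (trans m≡q*d (ℕP.*-comm q d))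
                                      (pow≡e⇒ord∣ s (d ℕ.* r) (trans (pow-* s r d) eq)))
    ... | divides r′ r≡r′*q = r′ , trans (sym (pow-* s q r′)) (cong (pow s) (sym r≡r′*q))
    s^a∈⟨w⟩ : Σ[ r′ ∈ ℕ ] pow w r′ ≡ pow s a
    s^a∈⟨w⟩ = in-⟨w⟩ a (trans (cong (pow (pow s a)) (sym ord≡)) (pow-ord (pow s a)))
    t∈⟨w⟩ : Σ[ r′ ∈ ℕ ] pow w r′ ≡ t
    t∈⟨w⟩ = in-⟨w⟩ b (pow-ord t)
    a′ b′ : ℕ
    a′ = proj₁ s^a∈⟨w⟩
    b′ = proj₁ t∈⟨w⟩
    w^a′≡s^a : pow w a′ ≡ pow s a
    w^a′≡s^a = proj₂ s^a∈⟨w⟩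
    w^b′≡t : pow w b′ ≡ t
    w^b′≡t = proj₂ t∈⟨w⟩
    w∈⟨t⟩ : Σ[ c ∈ ℕ ] pow (pow w b′) c ≡ w
    w∈⟨t⟩ = coprime⇒generates w b′ (ord-pow≡⇒coprime w b′ (trans (cong ord w^b′≡t) (sym ord-w)))
    c : ℕ
    c = proj₁ w∈⟨t⟩
    w≡ : pow (pow w b′) c ≡ w
    w≡ = proj₂ w∈⟨t⟩

module CyclicSubgroup (G : FinGroup) where
  open GroupTheory G
  open GroupFacts G

  pow-reduce : ∀ s k → Σ[ r ∈ ℕ ] (r < ord s × pow s r ≡ pow s k)
  pow-reduce s k = k % ord s , m%n<n k (ord s) , sym (pow-mod s k)

  anyPow-intro : ∀ s (p : Fin n → Bool) k → p (pow s k) ≡ true → anyUpTo n (λ r → p (pow s r)) ≡ true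
  anyPow-intro s p k pk with pow-reduce s k
  ... | r , r<ord , sʳ≡sᵏ = anyUpTo-intro n _ (ℕP.<⇒≤ (ℕP.<-≤-trans r<ord (ord-≤n s)))
                               (subst (λ z → p z ≡ true) (sym sʳ≡sᵏ) pk)

  pow∈cyc : ∀ s k → cyc s (pow s k) ≡ true
  pow∈cyc s k = anyPow-intro s (λ z → z == pow s k) k (==-intro refl)

  cyc-intro : ∀ s k {y} → pow s k ≡ y → cyc s y ≡ true
  cyc-intro s k refl = pow∈cyc s k

  cyc-elim : ∀ s {y} → cyc s y ≡ true → Σ[ k ∈ ℕ ] pow s k ≡ y
  cyc-elim s h with anyUpTo-elim n _ h
  ... | k , _ , sᵏ==y = k , ==-elim sᵏ==y

  cyc-trans : ∀ s t {y} → cyc s t ≡ true → cyc t y ≡ true → cyc s y ≡ true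
  cyc-trans s t t∈⟨s⟩ y∈⟨t⟩ with cyc-elim s t∈⟨s⟩ | cyc-elim t y∈⟨t⟩
  ... | a , refl | b , refl = cyc-intro s (b ℕ.* a) (pow-* s a b)

  cyc-cj : ∀ g s y → cyc (cj g s) (cj g y) ≡ cyc s y
  cyc-cj g s y = bool-ext to from
    where
    to : cyc (cj g s) (cj g y) ≡ true → cyc s y ≡ true
    to h with cyc-elim (cj g s) h
    ... | k , eq = cyc-intro s k (cj-injective g (trans (cj-pow g s k) eq))
    from : cyc s y ≡ true → cyc (cj g s) (cj g y) ≡ true
    from h with cyc-elim s h
    ... | k , refl = cyc-intro (cj g s) k (sym (cj-pow g s k))

  cyc-generator : ∀ s y a → ord (pow y a) ≡ ord y → cyc s (pow y a) ≡ cyc s y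
  cyc-generator s y a ord≡ = bool-ext (λ h → cyc-trans s (pow y a) h (cyc-intro (pow y a) c y≡))
                                      (λ h → cyc-trans s y h (pow∈cyc y a))
    where
    c : ℕ
    c = proj₁ (coprime⇒generates y a (ord-pow≡⇒coprime y a ord≡))
    y≡ : pow (pow y a) c ≡ y
    y≡ = proj₂ (coprime⇒generates y a (ord-pow≡⇒coprime y a ord≡))

  powers : ∀ s → Fin (ord s) → Fin n
  powers s i = pow s (suc (toℕ i))

  powers-injective : ∀ s {i j} → powers s i ≡ powers s j → i ≡ j
  powers-injective s {i} {j} eq =
    FinP.toℕ-injective (pow-injective s (FinP.toℕ<n i) (FinP.toℕ<n j) (cancelˡ eq))

  powers-onto : ∀ s y → cyc s y ≡ true → Σ[ i ∈ Fin (ord s) ] powers s i ≡ y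
  powers-onto s y y∈⟨s⟩ with cyc-elim s y∈⟨s⟩
  ... | k , sᵏ≡y with pow-reduce s k
  ...   | zero , _ , s⁰≡sᵏ = Fin.fromℕ< last<ord , (begin
            pow s (suc (toℕ (Fin.fromℕ< last<ord)))  ≡⟨ cong (λ z → pow s (suc z)) (FinP.toℕ-fromℕ< last<ord) ⟩
            pow s (suc (ord s ℕ.∸ 1))                 ≡⟨ cong (pow s) (ℕP.m+[n∸m]≡n (ord-pos s)) ⟩
            pow s (ord s)                             ≡⟨ pow-ord s ⟩
            e                                         ≡⟨ trans s⁰≡sᵏ sᵏ≡y ⟩
            y                                         ∎)
    where
    open ≡-Reasoning
    last<ord : ord s ℕ.∸ 1 < ord s
    last<ord = ℕP.∸-monoʳ-< {o = 0} (s≤s z≤n) (ord-pos s)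
  ...   | suc r , 1+r<ord , sʳ≡sᵏ = Fin.fromℕ< r<ord ,
            trans (cong (λ z → pow s (suc z)) (FinP.toℕ-fromℕ< r<ord)) (trans sʳ≡sᵏ sᵏ≡y)
    where
    r<ord : r < ord s
    r<ord = ℕP.<-trans (ℕP.n<1+n r) 1+r<ord

  ∑-cyc : ∀ s (h : Fin n → ℚ) → ∑ (λ y → if cyc s y then h y else 0ℚ) ≡ ∑ (λ i → h (powers s i))
  ∑-cyc s h = ∑-reindex (powers s) (powers-injective s) (cyc s) (powers-onto s) (λ i → pow∈cyc s (suc (toℕ i))) h

  card-cyc : ∀ s → fromℕ (card (cyc s)) ≡ fromℕ (ord s)
  card-cyc s = begin
    fromℕ (count (cyc s))                         ≡⟨ count≡∑𝟙 (cyc s) ⟩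
    ∑ (λ y → if cyc s y then 1ℚ else 0ℚ)          ≡⟨ ∑-cyc s (λ _ → 1ℚ) ⟩
    ∑ {ord s} (λ _ → 1ℚ)                          ≡⟨ ∑-const {ord s} 1ℚ ⟩
    fromℕ (ord s) ℚ.* 1ℚ                           ≡⟨ ℚP.*-identityʳ _ ⟩
    fromℕ (ord s)                                 ∎
    where open ≡-Reasoning

  generators-count : ∀ t → ∑ (λ y → if cyc t y then 𝟙 ⌊ ord y ℕ.≟ ord t ⌋ else 0ℚ) ≡ fromℕ (totient (ord t))
  generators-count t = begin
    ∑ (λ y → if cyc t y then 𝟙 (same-order y) else 0ℚ)  ≡⟨ ∑-cyc t (λ y → 𝟙 (same-order y)) ⟩
    ∑ (λ i → 𝟙 (same-order (powers t i)))               ≡⟨ ∑-cong (λ i → cong 𝟙 (bool-ext (to i) (from i))) ⟩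
    ∑ (λ i → 𝟙 (unit i))                                ≡⟨ sym (count≡∑𝟙 unit) ⟩
    fromℕ (totient (ord t))                             ∎
    where
    open ≡-Reasoning
    same-order : Fin n → Bool
    same-order y = ⌊ ord y ℕ.≟ ord t ⌋
    unit : Fin (ord t) → Bool
    unit i = ⌊ gcd (suc (toℕ i)) (ord t) ℕ.≟ 1 ⌋
    to : ∀ i → same-order (powers t i) ≡ true → unit i ≡ true
    to i h = ⌊⌋-intro _ (coprime⇒gcd≡1 (ord-pow≡⇒coprime t (suc (toℕ i)) (⌊⌋-elim h)))
    from : ∀ i → unit i ≡ true → same-order (powers t i) ≡ true
    from i h = ⌊⌋-intro _ (ord-pow-coprime t (suc (toℕ i)) (coprime-sym (gcd≡1⇒coprime (⌊⌋-elim h))))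

module PowerConjugacy (G : FinGroup) (I : Subgroup G) where
  open GroupTheory G
  open GroupFacts G
  open CyclicSubgroup G
  open Subgroup I renaming (mem to S)

  S-pow : ∀ x k → S x ≡ true → S (pow x k) ≡ true
  S-pow x zero    _   = mem-e
  S-pow x (suc k)   x∈S = mem-· x (pow x k) x∈S (S-pow x k x∈S)

  S-cj : ∀ g x → S g ≡ true → S x ≡ true → S (cj g x) ≡ true
  S-cj g x g∈S x∈S = mem-· _ _ (mem-· _ _ g∈S x∈S) (mem-inv g g∈S)

  S-cyc : ∀ s {y} → S s ≡ true → cyc s y ≡ true → S y ≡ true
  S-cyc s s∈S y∈⟨s⟩ with cyc-elim s y∈⟨s⟩
  ... | k , refl = S-pow s k s∈S

  conj-intro : ∀ g {x y} → S g ≡ true → cj g x ≡ y → conj S x y ≡ true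
  conj-intro g g∈S refl = anyF-intro _ g (∧-intro g∈S (==-intro refl))

  conj-elim : ∀ {x y} → conj S x y ≡ true → Σ[ g ∈ Fin n ] (S g ≡ true × cj g x ≡ y)
  conj-elim h with anyF-elim _ h
  ... | g , p = g , ∧-elimˡ p , ==-elim (∧-elimʳ p)

  conjPow-intro : ∀ x y k → conj S x (pow y k) ≡ true → conjPow S x y ≡ true
  conjPow-intro x y = anyPow-intro y (conj S x)

  conjPow-elim : ∀ {x y} → conjPow S x y ≡ true → Σ[ k ∈ ℕ ] conj S x (pow y k) ≡ true
  conjPow-elim h with anyUpTo-elim n _ h
  ... | k , _ , p = k , p

  conjPow-via : ∀ g {x y} k → S g ≡ true → cj g x ≡ pow y k → conjPow S x y ≡ true
  conjPow-via g {x} {y} k g∈S eq = conjPow-intro x y k (conj-intro g g∈S eq)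

  pconj-refl : ∀ x → pconj S x x ≡ true
  pconj-refl x = ∧-intro x≼x x≼x
    where
    x≼x : conjPow S x x ≡ true
    x≼x = conjPow-via e 1 mem-e (trans (cj-id x) (sym (pow-1 x)))

  pconj-sym : ∀ {x y} → pconj S x y ≡ true → pconj S y x ≡ true
  pconj-sym {x} {y} h = trans (∧-comm (conjPow S y x) (conjPow S x y)) h

  conjPow-trans : ∀ {x y z} → conjPow S x y ≡ true → conjPow S y z ≡ true → conjPow S x z ≡ true
  conjPow-trans {x} {y} {z} x≼y y≼z with conjPow-elim x≼y | conjPow-elim y≼z
  ... | a , x~yᵃ | b , y~zᵇ with conj-elim x~yᵃ | conj-elim y~zᵇ
  ...   | g , g∈S , gxg⁻¹≡yᵃ | h , h∈S , hyh⁻¹≡zᵇ =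
    conjPow-via (h · g) (a ℕ.* b) (mem-· h g h∈S g∈S) (begin
      cj (h · g) x        ≡⟨ sym (cj-comp h g x) ⟩
      cj h (cj g x)       ≡⟨ cong (cj h) gxg⁻¹≡yᵃ ⟩
      cj h (pow y a)      ≡⟨ cj-pow h y a ⟩
      pow (cj h y) a      ≡⟨ cong (λ w → pow w a) hyh⁻¹≡zᵇ ⟩
      pow (pow z b) a     ≡⟨ sym (pow-* z b a) ⟩
      pow z (a ℕ.* b)     ∎)
    where open ≡-Reasoning

  pconj-trans : ∀ {x y z} → pconj S x y ≡ true → pconj S y z ≡ true → pconj S x z ≡ true
  pconj-trans x~y y~z = ∧-intro (conjPow-trans (∧-elimˡ x~y) (∧-elimˡ y~z))
                                (conjPow-trans (∧-elimʳ y~z) (∧-elimʳ x~y))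

  conj⇒pconj : ∀ g x → S g ≡ true → pconj S x (cj g x) ≡ true
  conj⇒pconj g x g∈S =
    ∧-intro (conjPow-via g 1 g∈S (sym (pow-1 _)))
            (conjPow-via (inv g) 1 (mem-inv g g∈S) (trans (cj-invˡ g x) (sym (pow-1 x))))

  same-order-power⇒pconj : ∀ t b → ord (pow t b) ≡ ord t → pconj S (pow t b) t ≡ true
  same-order-power⇒pconj t b ord≡ with coprime⇒generates t b (ord-pow≡⇒coprime t b ord≡)
  ... | c , tᵇᶜ≡t = ∧-intro (conjPow-via e b mem-e (cj-id _))
                            (conjPow-via e c mem-e (trans (cj-id t) (sym tᵇᶜ≡t)))

  conjPow⇒ord∣ : ∀ {x y} → conjPow S x y ≡ true → ord x ∣ ord y
  conjPow⇒ord∣ {x} {y} x≼y with conjPow-elim x≼y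
  ... | a , x~yᵃ with conj-elim x~yᵃ
  ...   | g , _ , gxg⁻¹≡yᵃ = subst (_∣ ord y) (trans (cong ord (sym gxg⁻¹≡yᵃ)) (ord-cj g x))
                                   (ord-pow∣ord y a)

  pconj⇒ord≡ : ∀ {x y} → pconj S x y ≡ true → ord x ≡ ord y
  pconj⇒ord≡ x~y = ∣-antisym (conjPow⇒ord∣ (∧-elimˡ x~y)) (conjPow⇒ord∣ (∧-elimʳ x~y))

  divs-intro : ∀ t s k → S s ≡ true → pconj S (pow s k) t ≡ true → divs S t s ≡ true
  divs-intro t s k s∈S sᵏ~t =
    anyF-intro _ s (∧-intro s∈S (∧-intro (pconj-refl s) (anyPow-intro s (λ z → pconj S z t) k sᵏ~t)))

  divs-elim : ∀ t s → divs S t s ≡ true → Σ[ c ∈ ℕ ] pconj S (pow s c) t ≡ true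
  divs-elim t s h with anyF-elim _ h
  ... | s′ , p with conjPow-elim s′≼s | anyUpTo-elim n _ some-power
    where
    s′~s×power : pconj S s′ s ∧ anyUpTo n (λ k → pconj S (pow s′ k) t) ≡ true
    s′~s×power = ∧-elimʳ {S s′} p
    s′≼s : conjPow S s′ s ≡ true
    s′≼s = ∧-elimˡ (∧-elimˡ {pconj S s′ s} s′~s×power)
    some-power : anyUpTo n (λ k → pconj S (pow s′ k) t) ≡ true
    some-power = ∧-elimʳ {pconj S s′ s} s′~s×power
  ...   | a , s′~sᵃ | k , _ , s′ᵏ~t with conj-elim s′~sᵃ
  ...     | g , g∈S , gs′g⁻¹≡sᵃ = k ℕ.* a , pconj-trans sᵃᵏ~s′ᵏ s′ᵏ~t
    where
    sᵃᵏ≡ : pow s (k ℕ.* a) ≡ cj g (pow s′ k)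
    sᵃᵏ≡ = trans (pow-* s a k) (trans (cong (λ z → pow z k) (sym gs′g⁻¹≡sᵃ)) (sym (cj-pow g s′ k)))
    sᵃᵏ~s′ᵏ : pconj S (pow s (k ℕ.* a)) (pow s′ k) ≡ true
    sᵃᵏ~s′ᵏ = subst (λ z → pconj S z (pow s′ k) ≡ true) (sym sᵃᵏ≡)
                    (pconj-sym (conj⇒pconj g (pow s′ k) g∈S))

  -- If u = s^c lies in the class of t, the class of t meets ⟨s⟩ exactly in the
  -- generators of ⟨u⟩ (⟨s⟩ has only one cyclic subgroup of order ord t).
  class∩cyc≡generators : ∀ t s c → S s ≡ true → pconj S (pow s c) t ≡ true → ∀ y
    → (S y ∧ pconj S y t) ∧ cyc s y ≡ cyc (pow s c) y ∧ ⌊ ord y ℕ.≟ ord (pow s c) ⌋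
  class∩cyc≡generators t s c s∈S u~t y = bool-ext to from
    where
    u : Fin n
    u = pow s c
    to : (S y ∧ pconj S y t) ∧ cyc s y ≡ true → cyc u y ∧ ⌊ ord y ℕ.≟ ord u ⌋ ≡ true
    to h with cyc-elim s (∧-elimʳ {S y ∧ pconj S y t} h)
    ... | a , refl = ∧-intro (cyc-intro u (proj₁ sᵃ∈⟨u⟩) (proj₂ sᵃ∈⟨u⟩)) (⌊⌋-intro (ord (pow s a) ℕ.≟ ord u) ord≡)
      where
      ord≡ : ord (pow s a) ≡ ord u
      ord≡ = trans (pconj⇒ord≡ (∧-elimʳ {S (pow s a)} (∧-elimˡ h))) (sym (pconj⇒ord≡ u~t))
      sᵃ∈⟨u⟩ : Σ[ c′ ∈ ℕ ] pow u c′ ≡ pow s a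
      sᵃ∈⟨u⟩ = same-order⇒power s a c ord≡
    from : cyc u y ∧ ⌊ ord y ℕ.≟ ord u ⌋ ≡ true → (S y ∧ pconj S y t) ∧ cyc s y ≡ true
    from h with cyc-elim u (∧-elimˡ h)
    ... | b , refl = ∧-intro (∧-intro (S-pow u b (S-pow s c s∈S)) uᵇ~t) (cyc-trans s u (pow∈cyc s c) (∧-elimˡ h))
      where
      uᵇ~t : pconj S (pow u b) t ≡ true
      uᵇ~t = pconj-trans (same-order-power⇒pconj u b ord≡) u~t
        where
        ord≡ : ord (pow u b) ≡ ord u
        ord≡ = ⌊⌋-elim {a? = ord (pow u b) ℕ.≟ ord u} (∧-elimʳ {cyc u (pow u b)} h)

  class∩cyc-count : ∀ t s c → S s ≡ true → pconj S (pow s c) t ≡ true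
    → ∑ (λ y → if S y ∧ pconj S y t then 𝟙 (cyc s y) else 0ℚ) ≡ fromℕ (totient (ord t))
  class∩cyc-count t s c s∈S u~t = begin
    ∑ (λ y → if S y ∧ pconj S y t then 𝟙 (cyc s y) else 0ℚ)
      ≡⟨ ∑-cong same-terms ⟩
    ∑ (λ y → if cyc u y then 𝟙 ⌊ ord y ℕ.≟ ord u ⌋ else 0ℚ)
      ≡⟨ generators-count u ⟩
    fromℕ (totient (ord u))
      ≡⟨ cong fromℕ (cong totient (pconj⇒ord≡ u~t)) ⟩
    fromℕ (totient (ord t)) ∎
    where
    open ≡-Reasoning
    u : Fin n
    u = pow s c
    same-terms : ∀ y → (if S y ∧ pconj S y t then 𝟙 (cyc s y) else 0ℚ)
                     ≡ (if cyc u y then 𝟙 ⌊ ord y ℕ.≟ ord u ⌋ else 0ℚ)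
    same-terms y = begin
      (if S y ∧ pconj S y t then 𝟙 (cyc s y) else 0ℚ)   ≡⟨ if-𝟙 (S y ∧ pconj S y t) (cyc s y) ⟩
      𝟙 ((S y ∧ pconj S y t) ∧ cyc s y)                 ≡⟨ cong 𝟙 (class∩cyc≡generators t s c s∈S u~t y) ⟩
      𝟙 (cyc u y ∧ ⌊ ord y ℕ.≟ ord u ⌋)                 ≡⟨ sym (if-𝟙 (cyc u y) ⌊ ord y ℕ.≟ ord u ⌋) ⟩
      (if cyc u y then 𝟙 ⌊ ord y ℕ.≟ ord u ⌋ else 0ℚ)   ∎

  class∩cyc : ∀ t s → S s ≡ true
    → ∑ (λ y → if S y ∧ pconj S y t then 𝟙 (cyc s y) else 0ℚ) ≡ (if divs S t s then fromℕ (totient (ord t)) else 0ℚ)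
  class∩cyc t s s∈S = by-cases (divs S t s) refl
    where
    by-cases : ∀ b → divs S t s ≡ b
      → ∑ (λ y → if S y ∧ pconj S y t then 𝟙 (cyc s y) else 0ℚ) ≡ (if b then fromℕ (totient (ord t)) else 0ℚ)
    by-cases true t∣s = trans (class∩cyc-count t s (proj₁ sᶜ~t) s∈S (proj₂ sᶜ~t)) (if-true _)
      where
      sᶜ~t : Σ[ c ∈ ℕ ] pconj S (pow s c) t ≡ true
      sᶜ~t = divs-elim t s t∣s
    by-cases false t∤s = ∑-zero _ (λ y → trans (if-𝟙 (S y ∧ pconj S y t) (cyc s y)) (cong 𝟙 (outside y)))
      where
      outside : ∀ y → (S y ∧ pconj S y t) ∧ cyc s y ≡ false
      outside y = bool-ext inside⇒t∣s λ ()
        where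
        inside⇒t∣s : (S y ∧ pconj S y t) ∧ cyc s y ≡ true → false ≡ true
        inside⇒t∣s h with cyc-elim s (∧-elimʳ {S y ∧ pconj S y t} h)
        ... | k , refl = trans (sym t∤s) (divs-intro t s k s∈S (∧-elimʳ {S (pow s k)} (∧-elimˡ h)))

module IndicatorIdentity (G : FinGroup) (I : Subgroup G) (u : Fin (FinGroup.n G) → ℚ)
                         (isU : GroupTheory.IsU G (Subgroup.mem I) u) where
  open GroupTheory G
  open GroupFacts G
  open CyclicSubgroup G
  open PowerConjugacy G I
  open Subgroup I renaming (mem to S)
  open +-*-Solver using (solve; _:*_; _:=_)

  u-class : ∀ x y → S x ≡ true → S y ≡ true → pconj S x y ≡ true → u x ≡ u y
  u-class = proj₁ isU

  u-system : ∀ t → S t ≡ true → classSum S (divs S t) (λ s → dd S t s * u s) ≡ 1ℚ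
  u-system = proj₂ isU

  φ : Fin n → ℚ
  φ s = fromℕ (totient (ord s))

  |C| : Fin n → ℚ
  |C| x = fromℕ (classSize S x)

  φ≢0 : ∀ s → φ s ≢ 0ℚ
  φ≢0 s = totient≢0 (ord s) (ord-pos s)

  |C|≢0 : ∀ x → S x ≡ true → |C| x ≢ 0ℚ
  |C|≢0 x x∈S = count≢0 (λ y → S y ∧ pconj S y x) x (∧-intro x∈S (pconj-refl x))

  -- The weight u_σ / φ(σ̄) of an element s of I; opaque (with its defining equation w-def)
  -- so that comparisons of weights never unfold rational arithmetic.
  opaque
    w : Fin n → ℚ
    w s = u s * recip (φ s)

    w-def : ∀ s → w s ≡ u s * recip (φ s)
    w-def s = refl

  A : Fin n → ℚ
  A y = ∑ (λ s → if S s then w s * 𝟙 (cyc s y) else 0ℚ)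

  S-cj-eq : ∀ g s → S g ≡ true → S (cj g s) ≡ S s
  S-cj-eq g s g∈S = bool-ext (λ h → subst (λ z → S z ≡ true) (cj-invˡ g s) (S-cj (inv g) _ (mem-inv g g∈S) h))
                             (S-cj g s g∈S)

  w-cj : ∀ g s → S g ≡ true → S s ≡ true → w (cj g s) ≡ w s
  w-cj g s g∈S s∈S = begin
    w (cj g s)                         ≡⟨ w-def (cj g s) ⟩
    u (cj g s) * recip (φ (cj g s))    ≡⟨ cong₂ _*_ u≡ (cong recip (cong fromℕ (cong totient (ord-cj g s)))) ⟩
    u s * recip (φ s)                  ≡⟨ w-def s ⟨
    w s                                ∎
    where
    open ≡-Reasoning
    u≡ : u (cj g s) ≡ u s
    u≡ = u-class (cj g s) s (trans (S-cj-eq g s g∈S) s∈S) s∈S (pconj-sym (conj⇒pconj g s g∈S))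

  A-cj : ∀ g y → S g ≡ true → A (cj g y) ≡ A y
  A-cj g y g∈S = begin
    A (cj g y)                 ≡⟨ sym (∑-permute (cj g) (cj-injective g) (λ z → cj (inv g) z , cj-invʳ g z) term) ⟩
    ∑ (λ s → term (cj g s))    ≡⟨ ∑-cong term-cj ⟩
    A y                        ∎
    where
    open ≡-Reasoning
    term : Fin n → ℚ
    term s = if S s then w s * 𝟙 (cyc s (cj g y)) else 0ℚ
    term-cj : ∀ s → term (cj g s) ≡ (if S s then w s * 𝟙 (cyc s y) else 0ℚ)
    term-cj s = trans (cong (if_then w (cj g s) * 𝟙 (cyc (cj g s) (cj g y)) else 0ℚ) (S-cj-eq g s g∈S))
                      (if-cong (S s) (λ s∈S → cong₂ _*_ (w-cj g s g∈S s∈S) (cong 𝟙 (cyc-cj g s y))))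

  A-generator : ∀ y a → ord (pow y a) ≡ ord y → A (pow y a) ≡ A y
  A-generator y a ord≡ = ∑-cong (λ s → cong (λ b → if S s then w s * 𝟙 b else 0ℚ) (cyc-generator s y a ord≡))

  -- y is conjugate in I to a power y′ᵏ of the same order as y′.
  A-pconj : ∀ {y y′} → pconj S y y′ ≡ true → A y ≡ A y′
  A-pconj {y} {y′} y~y′ = begin
    A y            ≡⟨ A-cj g y g∈S ⟨
    A (cj g y)     ≡⟨ cong A gyg⁻¹≡y′ᵏ ⟩
    A (pow y′ k)   ≡⟨ A-generator y′ k (trans (cong ord (sym gyg⁻¹≡y′ᵏ)) (trans (ord-cj g y) (pconj⇒ord≡ y~y′))) ⟩
    A y′           ∎
    where
    open ≡-Reasoning
    y≼y′ : Σ[ k ∈ ℕ ] conj S y (pow y′ k) ≡ true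
    y≼y′ = conjPow-elim (∧-elimˡ y~y′)
    k : ℕ
    k = proj₁ y≼y′
    conjugator : Σ[ g ∈ Fin n ] (S g ≡ true × cj g y ≡ pow y′ k)
    conjugator = conj-elim (proj₂ y≼y′)
    g : Fin n
    g = proj₁ conjugator
    g∈S : S g ≡ true
    g∈S = proj₁ (proj₂ conjugator)
    gyg⁻¹≡y′ᵏ : cj g y ≡ pow y′ k
    gyg⁻¹≡y′ᵏ = proj₂ (proj₂ conjugator)

  weights-of-multiples : ∀ t → S t ≡ true → ∑ (λ s → if S s ∧ divs S t s then w s else 0ℚ) ≡ bracket S t
  weights-of-multiples t t∈S = recip-solve (bracket S t) W (bracket≢0) (begin
    recip (bracket S t) * W
      ≡⟨ ∑-*ˡ (recip (bracket S t)) (λ s → if S s ∧ divs S t s then w s else 0ℚ) ⟨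
    ∑ (λ s → recip (bracket S t) * (if S s ∧ divs S t s then w s else 0ℚ))
      ≡⟨ ∑-cong (λ s → trans (if-*ˡ (S s ∧ divs S t s) (recip (bracket S t)) (w s))
                             (if-cong (S s ∧ divs S t s) (λ h → sym (term s (∧-elimˡ h))))) ⟩
    classSum S (divs S t) (λ s → dd S t s * u s)
      ≡⟨ u-system t t∈S ⟩
    1ℚ ∎)
    where
    open ≡-Reasoning
    W : ℚ
    W = ∑ (λ s → if S s ∧ divs S t s then w s else 0ℚ)
    bracket≢0 : bracket S t ≢ 0ℚ
    bracket≢0 = ÷'≢0 (fromℕ (classSize S t)) (fromℕ (totient (ord t))) (|C|≢0 t t∈S) (φ≢0 t)
    term : ∀ s → S s ≡ true → (dd S t s * u s) ÷' fromℕ (classSize S s) ≡ recip (bracket S t) * w s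
    term s s∈S = begin
      (dd S t s * u s) ÷' c
        ≡⟨ ÷'≡*recip (dd S t s * u s) c ⟩
      (dd S t s * u s) * recip c
        ≡⟨ cong (λ d → (d * u s) * recip c) (trans (÷'≡*recip (bracket S s) (bracket S t))
                                              (cong (_* recip (bracket S t)) (÷'≡*recip c (φ s)))) ⟩
      (((c * recip (φ s)) * recip (bracket S t)) * u s) * recip c
        ≡⟨ cancel c (recip (φ s)) (recip (bracket S t)) (u s) (recip c) (*-recip c (|C|≢0 s s∈S)) ⟩
      recip (bracket S t) * (u s * recip (φ s))
        ≡⟨ cong (recip (bracket S t) *_) (w-def s) ⟨
      recip (bracket S t) * w s ∎
      where
      c : ℚ
      c = fromℕ (classSize S s)
      cancel : ∀ c r b v r′ → c * r′ ≡ 1ℚ → (((c * r) * b) * v) * r′ ≡ b * (v * r)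
      cancel c r b v r′ c·r′≡1 = begin
        (((c * r) * b) * v) * r′  ≡⟨ solve 5 (λ c r b v r′ → (((c :* r) :* b) :* v) :* r′
                                                            := (c :* r′) :* (b :* (v :* r))) refl c r b v r′ ⟩
        (c * r′) * (b * (v * r))  ≡⟨ cong (_* (b * (v * r))) c·r′≡1 ⟩
        1ℚ * (b * (v * r))        ≡⟨ ℚP.*-identityˡ (b * (v * r)) ⟩
        b * (v * r)               ∎
        where open ≡-Reasoning

  -- Double counting the pairs (y, s) with y ∈ C_τ, s ∈ I, y ∈ ⟨s⟩:
  -- Σ_{y ∈ C_τ} A(y) = φ(ord t) · Σ_{s ∈ I, τ ∣ σ} w(s).
  class-sum-by-double-counting : ∀ t → ∑ (λ y → if S y ∧ pconj S y t then A y else 0ℚ)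
                        ≡ φ t * ∑ (λ s → if S s ∧ divs S t s then w s else 0ℚ)
  class-sum-by-double-counting t = begin
    ∑ (λ y → if C y then A y else 0ℚ)
      ≡⟨ ∑-cong (λ y → sym (∑-if (C y) (λ s → term s y))) ⟩
    ∑ (λ y → ∑ (λ s → if C y then term s y else 0ℚ))
      ≡⟨ ∑-swap (λ y s → if C y then term s y else 0ℚ) ⟩
    ∑ (λ s → ∑ (λ y → if C y then term s y else 0ℚ))
      ≡⟨ ∑-cong per-s ⟩
    ∑ (λ s → φ t * (if S s ∧ divs S t s then w s else 0ℚ))
      ≡⟨ ∑-*ˡ (φ t) (λ s → if S s ∧ divs S t s then w s else 0ℚ) ⟩
    φ t * ∑ (λ s → if S s ∧ divs S t s then w s else 0ℚ) ∎
    where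
    open ≡-Reasoning
    C : Fin n → Bool
    C y = S y ∧ pconj S y t
    term : Fin n → Fin n → ℚ
    term s y = if S s then w s * 𝟙 (cyc s y) else 0ℚ
    per-s : ∀ s → ∑ (λ y → if C y then term s y else 0ℚ) ≡ φ t * (if S s ∧ divs S t s then w s else 0ℚ)
    per-s s = by-cases (S s) refl
      where
      by-cases : ∀ b → S s ≡ b → ∑ (λ y → if C y then (if b then w s * 𝟙 (cyc s y) else 0ℚ) else 0ℚ)
                                  ≡ φ t * (if b ∧ divs S t s then w s else 0ℚ)
      by-cases false _ = trans (∑-zero _ (λ y → if-0 (C y))) (sym (ℚP.*-zeroʳ (φ t)))
      by-cases true s∈S = begin
        ∑ (λ y → if C y then w s * 𝟙 (cyc s y) else 0ℚ)
          ≡⟨ ∑-cong (λ y → sym (if-*ˡ (C y) (w s) (𝟙 (cyc s y)))) ⟩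
        ∑ (λ y → w s * (if C y then 𝟙 (cyc s y) else 0ℚ))
          ≡⟨ ∑-*ˡ (w s) (λ y → if C y then 𝟙 (cyc s y) else 0ℚ) ⟩
        w s * ∑ (λ y → if C y then 𝟙 (cyc s y) else 0ℚ)
          ≡⟨ cong (w s *_) (class∩cyc t s s∈S) ⟩
        w s * (if divs S t s then φ t else 0ℚ)
          ≡⟨ if-*ˡ (divs S t s) (w s) (φ t) ⟩
        (if divs S t s then w s * φ t else 0ℚ)
          ≡⟨ if-cong (divs S t s) (λ _ → ℚP.*-comm (w s) (φ t)) ⟩
        (if divs S t s then φ t * w s else 0ℚ)
          ≡⟨ if-*ˡ (divs S t s) (φ t) (w s) ⟨
        φ t * (if divs S t s then w s else 0ℚ) ∎

  -- Since A is constant on C_τ: Σ_{y ∈ C_τ} A(y) = A(t) · |C_τ|.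
  class-sum-by-constancy : ∀ t → ∑ (λ y → if S y ∧ pconj S y t then A y else 0ℚ) ≡ A t * |C| t
  class-sum-by-constancy t = begin
    ∑ (λ y → if S y ∧ pconj S y t then A y else 0ℚ)
      ≡⟨ ∑-cong (λ y → if-cong (S y ∧ pconj S y t) (λ h → A-pconj (∧-elimʳ {S y} h))) ⟩
    ∑ (λ y → if S y ∧ pconj S y t then A t else 0ℚ)
      ≡⟨ ∑-cong (λ y → if≡*𝟙 (S y ∧ pconj S y t) (A t)) ⟩
    ∑ (λ y → A t * 𝟙 (S y ∧ pconj S y t))
      ≡⟨ ∑-*ˡ (A t) (λ y → 𝟙 (S y ∧ pconj S y t)) ⟩
    A t * ∑ (λ y → 𝟙 (S y ∧ pconj S y t))
      ≡⟨ cong (A t *_) (count≡∑𝟙 (λ y → S y ∧ pconj S y t)) ⟨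
    A t * |C| t ∎
    where open ≡-Reasoning

  -- A = 1 on I: A(t)·|C_τ| = φ(ord t)·[τ] = |C_τ|.
  A-on-I : ∀ t → S t ≡ true → A t ≡ 1ℚ
  A-on-I t t∈S = *-cancel-to-1 (A t) (|C| t) (|C|≢0 t t∈S) (begin
    A t * |C| t
      ≡⟨ class-sum-by-constancy t ⟨
    ∑ (λ y → if S y ∧ pconj S y t then A y else 0ℚ)
      ≡⟨ class-sum-by-double-counting t ⟩
    φ t * ∑ (λ s → if S s ∧ divs S t s then w s else 0ℚ)
      ≡⟨ cong (φ t *_) (weights-of-multiples t t∈S) ⟩
    φ t * bracket S t
      ≡⟨ cong (φ t *_) (÷'≡*recip (|C| t) (φ t)) ⟩
    φ t * (|C| t * recip (φ t))
      ≡⟨ solve 3 (λ p c r → p :* (c :* r) := c :* (p :* r)) refl (φ t) (|C| t) (recip (φ t)) ⟩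
    |C| t * (φ t * recip (φ t))
      ≡⟨ cong (|C| t *_) (*-recip (φ t) (φ≢0 t)) ⟩
    |C| t * 1ℚ
      ≡⟨ ℚP.*-identityʳ (|C| t) ⟩
    |C| t ∎)
    where open ≡-Reasoning

  -- A = 0 off I, since every ⟨s⟩ with s ∈ I lies in I.
  A-off-I : ∀ y → S y ≡ false → A y ≡ 0ℚ
  A-off-I y y∉S = ∑-zero _ term≡0
    where
    y∉⟨s⟩ : ∀ s → S s ≡ true → cyc s y ≡ false
    y∉⟨s⟩ s s∈S = bool-ext (λ y∈⟨s⟩ → trans (sym y∉S) (S-cyc s s∈S y∈⟨s⟩)) λ ()
    term≡0 : ∀ s → (if S s then w s * 𝟙 (cyc s y) else 0ℚ) ≡ 0ℚ
    term≡0 s = begin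
      (if S s then w s * 𝟙 (cyc s y) else 0ℚ)  ≡⟨ if-cong (S s) (λ s∈S → cong (w s *_) (cong 𝟙 (y∉⟨s⟩ s s∈S))) ⟩
      (if S s then w s * 𝟙 false else 0ℚ)      ≡⟨ if-cong (S s) (λ _ → ℚP.*-zeroʳ (w s)) ⟩
      (if S s then 0ℚ else 0ℚ)                 ≡⟨ if-0 (S s) ⟩
      0ℚ                                       ∎
      where open ≡-Reasoning

  A≡𝟙 : ∀ y → A y ≡ 𝟙 (S y)
  A≡𝟙 y = by-cases (S y) refl
    where
    by-cases : ∀ b → S y ≡ b → A y ≡ 𝟙 b
    by-cases true  y∈S = A-on-I y y∈S
    by-cases false y∉S = A-off-I y y∉S

  weighted-count : ∀ (q : Fin n → Fin n)
    → ∑ (λ s → if S s then w s * fromℕ (count (λ x → cyc s (q x))) else 0ℚ) ≡ fromℕ (count (λ x → S (q x)))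
  weighted-count q = begin
    ∑ (λ s → if S s then w s * fromℕ (count (λ x → cyc s (q x))) else 0ℚ)
      ≡⟨ ∑-cong expand ⟩
    ∑ (λ s → ∑ (λ x → if S s then w s * 𝟙 (cyc s (q x)) else 0ℚ))
      ≡⟨ ∑-swap (λ s x → if S s then w s * 𝟙 (cyc s (q x)) else 0ℚ) ⟩
    ∑ (λ x → A (q x))
      ≡⟨ ∑-cong (λ x → A≡𝟙 (q x)) ⟩
    ∑ (λ x → 𝟙 (S (q x)))
      ≡⟨ count≡∑𝟙 (λ x → S (q x)) ⟨
    fromℕ (count (λ x → S (q x))) ∎
    where
    open ≡-Reasoning
    expand : ∀ s → (if S s then w s * fromℕ (count (λ x → cyc s (q x))) else 0ℚ)
                 ≡ ∑ (λ x → if S s then w s * 𝟙 (cyc s (q x)) else 0ℚ)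
    expand s = begin
      (if S s then w s * fromℕ (count (λ x → cyc s (q x))) else 0ℚ)
        ≡⟨ if-cong (S s) (λ _ → cong (w s *_) (count≡∑𝟙 (λ x → cyc s (q x)))) ⟩
      (if S s then w s * ∑ (λ x → 𝟙 (cyc s (q x))) else 0ℚ)
        ≡⟨ if-cong (S s) (λ _ → ∑-*ˡ (w s) (λ x → 𝟙 (cyc s (q x)))) ⟨
      (if S s then ∑ (λ x → w s * 𝟙 (cyc s (q x))) else 0ℚ)
        ≡⟨ ∑-if (S s) (λ x → w s * 𝟙 (cyc s (q x))) ⟨
      ∑ (λ x → if S s then w s * 𝟙 (cyc s (q x)) else 0ℚ) ∎

module ArtinFormula (G : FinGroup) (I : Subgroup G) (u : Fin (FinGroup.n G) → ℚ)
                    (isU : GroupTheory.IsU G (Subgroup.mem I) u) (g : Fin (FinGroup.n G)) where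
  open GroupTheory G
  open GroupFacts G
  open CyclicSubgroup G
  open IndicatorIdentity G I u isU
  open Subgroup I renaming (mem to S)
  open +-*-Solver using (solve; _:+_; _:-_; _:*_; _:=_; con)

  conjugate : Fin n → Fin n
  conjugate x = (inv x · g) · x

  fixers : (Fin n → Bool) → ℚ
  fixers H = fromℕ (count (λ x → H (conjugate x)))

  permChar-def : ∀ H → permChar H g ≡ fixers H * recip (fromℕ (card H))
  permChar-def H = ÷'≡*recip (fixers H) (fromℕ (card H))

  R : ℚ
  R = regChar g

  card-triv : fromℕ (card triv) ≡ 1ℚ
  card-triv = trans (count≡∑𝟙 triv) (trans (∑-single (λ y → 𝟙 (triv y)) e off-e) (cong 𝟙 (==-intro refl)))
    where
    off-e : ∀ y → y ≢ e → 𝟙 (triv y) ≡ 0ℚ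
    off-e y y≢e = cong 𝟙 (⌊⌋-false (y Fin.≟ e) y≢e)

  recip-1 : recip 1ℚ ≡ 1ℚ
  recip-1 = trans (sym (ℚP.*-identityˡ (recip 1ℚ))) (*-recip 1ℚ λ ())

  R≡fixers-triv : R ≡ fixers triv
  R≡fixers-triv = begin
    R                                           ≡⟨ permChar-def triv ⟩
    fixers triv * recip (fromℕ (card triv))     ≡⟨ cong (λ c → fixers triv * recip c) card-triv ⟩
    fixers triv * recip 1ℚ                      ≡⟨ cong (fixers triv *_) recip-1 ⟩
    fixers triv * 1ℚ                            ≡⟨ ℚP.*-identityʳ (fixers triv) ⟩
    fixers triv                                 ∎
    where open ≡-Reasoning

  tame-def : ∀ s → tame s g ≡ R - fixers (cyc s) * recip (fromℕ (ord s))
  tame-def s = cong (R -_) (trans (permChar-def (cyc s)) (cong (λ c → fixers (cyc s) * recip c) (card-cyc s)))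

  ord≢0 : ∀ s → fromℕ (ord s) ≢ 0ℚ
  ord≢0 s = subst (λ m → fromℕ m ≢ 0ℚ) (ℕP.suc-pred (ord s)) (fromℕ-suc≢0 (ℕ.pred (ord s)))

  term-value : ∀ s → S s ≡ true
    → (u s * bracket S s * fromℕ (ord s) * tame s g) ÷' fromℕ (classSize S s) ≡ w s * (fromℕ (ord s) * R - fixers (cyc s))
  term-value s s∈S = begin
    (u s * bracket S s * o * tame s g) ÷' c
      ≡⟨ ÷'≡*recip (u s * bracket S s * o * tame s g) c ⟩
    (u s * bracket S s * o * tame s g) * recip c
      ≡⟨ cong₂ (λ b a → (u s * b * o * a) * recip c) (÷'≡*recip c (φ s)) (tame-def s) ⟩
    (u s * (c * recip (φ s)) * o * (R - N * recip o)) * recip c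
      ≡⟨ clear (u s) c (recip c) (recip (φ s)) o (recip o) R N (*-recip c (|C|≢0 s s∈S)) (*-recip o (ord≢0 s)) ⟩
    (u s * recip (φ s)) * (o * R - N)
      ≡⟨ cong (_* (o * R - N)) (w-def s) ⟨
    w s * (o * R - N) ∎
    where
    open ≡-Reasoning
    c o N : ℚ
    c = fromℕ (classSize S s)
    o = fromℕ (ord s)
    N = fixers (cyc s)
    clear : ∀ U c rc rφ o ro R N → c * rc ≡ 1ℚ → o * ro ≡ 1ℚ
      → (U * (c * rφ) * o * (R - N * ro)) * rc ≡ (U * rφ) * (o * R - N)
    clear U c rc rφ o ro R N c·rc≡1 o·ro≡1 = begin
      (U * (c * rφ) * o * (R - N * ro)) * rc
        ≡⟨ solve 8 (λ U c rc rφ o ro R N → (U :* (c :* rφ) :* o :* (R :- N :* ro)) :* rc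
                      := (c :* rc) :* ((U :* rφ) :* (o :* R :- (o :* ro) :* N))) refl U c rc rφ o ro R N ⟩
      (c * rc) * ((U * rφ) * (o * R - (o * ro) * N))
        ≡⟨ cong₂ (λ a b → a * ((U * rφ) * (o * R - b * N))) c·rc≡1 o·ro≡1 ⟩
      1ℚ * ((U * rφ) * (o * R - 1ℚ * N))
        ≡⟨ solve 5 (λ U rφ o R N → con 1ℚ :* ((U :* rφ) :* (o :* R :- con 1ℚ :* N))
                                 := (U :* rφ) :* (o :* R :- N)) refl U rφ o R N ⟩
      (U * rφ) * (o * R - N) ∎

  -- ⟨e⟩ is the trivial subgroup, so the identity class contributes nothing.
  cyc-e : ∀ y → cyc e y ≡ triv y
  cyc-e y = bool-ext to from
    where
    to : cyc e y ≡ true → triv y ≡ true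
    to h = ==-intro (trans (sym (proj₂ (cyc-elim e h))) (pow-e (proj₁ (cyc-elim e h))))
    from : triv y ≡ true → cyc e y ≡ true
    from h = cyc-intro e 0 (sym (==-elim h))

  identity-term : w e * (fromℕ (ord e) * R - fixers (cyc e)) ≡ 0ℚ
  identity-term = begin
    w e * (fromℕ (ord e) * R - fixers (cyc e))  ≡⟨ cong₂ (λ o N → w e * (fromℕ o * R - N)) ord-e fixers-e ⟩
    w e * (fromℕ 1 * R - R)                     ≡⟨ solve 2 (λ W R → W :* (con 1ℚ :* R :- R) := con 0ℚ) refl (w e) R ⟩
    0ℚ                                          ∎
    where
    open ≡-Reasoning
    fixers-e : fixers (cyc e) ≡ R
    fixers-e = trans (cong fromℕ (count-cong (λ x → cyc-e (conjugate x)))) (sym R≡fixers-triv)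

  classSum-value : classSum S (λ s → not (s == e)) (λ s → u s * bracket S s * fromℕ (ord s) * tame s g)
                   ≡ R * fromℕ (card S) - fixers S
  classSum-value = begin
    classSum S (λ s → not (s == e)) (λ s → u s * bracket S s * fromℕ (ord s) * tame s g)
      ≡⟨ ∑-cong (λ s → term s (S s) (s == e) refl refl) ⟩
    ∑ (λ s → if S s then w s * (fromℕ (ord s) * R - fixers (cyc s)) else 0ℚ)
      ≡⟨ ∑-cong (λ s → split (S s) (w s) (fromℕ (ord s)) (fixers (cyc s))) ⟩
    ∑ (λ s → R * (if S s then w s * fromℕ (ord s) else 0ℚ) - (if S s then w s * fixers (cyc s) else 0ℚ))
      ≡⟨ ∑-sub (λ s → R * (if S s then w s * fromℕ (ord s) else 0ℚ)) (λ s → if S s then w s * fixers (cyc s) else 0ℚ) ⟩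
    ∑ (λ s → R * (if S s then w s * fromℕ (ord s) else 0ℚ)) - ∑ (λ s → if S s then w s * fixers (cyc s) else 0ℚ)
      ≡⟨ cong₂ _-_ (∑-*ˡ R (λ s → if S s then w s * fromℕ (ord s) else 0ℚ)) (weighted-count conjugate) ⟩
    R * ∑ (λ s → if S s then w s * fromℕ (ord s) else 0ℚ) - fixers S
      ≡⟨ cong (λ x → R * x - fixers S) order-sum ⟩
    R * fromℕ (card S) - fixers S ∎
    where
    open ≡-Reasoning
    term : ∀ s b c → S s ≡ b → (s == e) ≡ c
      → (if b ∧ not c then (u s * bracket S s * fromℕ (ord s) * tame s g) ÷' fromℕ (classSize S s) else 0ℚ)
        ≡ (if b then w s * (fromℕ (ord s) * R - fixers (cyc s)) else 0ℚ)
    term s false c  _   _   = refl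
    term s true false s∈S _ = term-value s s∈S
    term s true true  _ s≡e =
      sym (trans (cong (λ z → w z * (fromℕ (ord z) * R - fixers (cyc z))) (==-elim s≡e)) identity-term)
    split : ∀ b W o N → (if b then W * (o * R - N) else 0ℚ) ≡ R * (if b then W * o else 0ℚ) - (if b then W * N else 0ℚ)
    split true  W o N = solve 4 (λ W o R N → W :* (o :* R :- N) := R :* (W :* o) :- W :* N) refl W o R N
    split false W o N = solve 1 (λ R → con 0ℚ := R :* con 0ℚ :- con 0ℚ) refl R
    -- Σ_{s ∈ I} w(s) · ord s = |I|, the counting identity for q = id
    order-sum : ∑ (λ s → if S s then w s * fromℕ (ord s) else 0ℚ) ≡ fromℕ (card S)
    order-sum = trans (∑-cong (λ s → if-cong (S s) (λ _ → cong (w s *_) (sym (card-cyc s))))) (weighted-count (λ x → x))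

  artin-value : artin S g ≡ recip (fromℕ (card S)) * (R * fromℕ (card S) - fixers S)
  artin-value = begin
    R - permChar S g             ≡⟨ cong (R -_) (permChar-def S) ⟩
    R - fixers S * r             ≡⟨ cong (_- fixers S * r) (ℚP.*-identityʳ R) ⟨
    R * 1ℚ - fixers S * r        ≡⟨ cong (λ x → R * x - fixers S * r) (*-recip c (count≢0 S e mem-e)) ⟨
    R * (c * r) - fixers S * r   ≡⟨ solve 4 (λ R N c r → R :* (c :* r) :- N :* r := r :* (R :* c :- N)) refl R (fixers S) c r ⟩
    r * (R * c - fixers S)       ∎
    where
    open ≡-Reasoning
    c r : ℚ
    c = fromℕ (card S)
    r = recip c

lemma5p1 : (G : FinGroup) (I : Subgroup G) (u : Fin (FinGroup.n G) → ℚ)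
    → GroupTheory.IsU G (Subgroup.mem I) u
    → ∀ (g : Fin (FinGroup.n G))
    → GroupTheory.artin G (Subgroup.mem I) g
      ≡ (1ℚ ÷' fromℕ (GroupTheory.card G (Subgroup.mem I)))
        * GroupTheory.classSum G (Subgroup.mem I)
            (λ s → not (GroupTheory._==_ G s (FinGroup.e G)))
            (λ s → u s * GroupTheory.bracket G (Subgroup.mem I) s
                   * fromℕ (GroupTheory.ord G s) * GroupTheory.tame G s g)
lemma5p1 G I u isU g = begin
  artin S g                          ≡⟨ artin-value ⟩
  recip |I| * (R * |I| - fixers S)   ≡⟨ cong (recip |I| *_) classSum-value ⟨
  recip |I| * Σclasses               ≡⟨ cong (_* Σclasses) (recip-def |I|) ⟨
  (1ℚ ÷' |I|) * Σclasses             ∎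
  where
  open GroupTheory G
  open Subgroup I renaming (mem to S)
  open ArtinFormula G I u isU g
  open ≡-Reasoning
  |I| : ℚ
  |I| = fromℕ (card S)
  Σclasses : ℚ
  Σclasses = classSum S (λ s → not (s == e)) (λ s → u s * bracket S s * fromℕ (ord s) * tame s g)
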